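{- Let $q$ be a prime power, $d,s,t$ positive integers with $s\le t\le d+1<q$, and let $\omega$ be a generator of the multiplicative group $\mathbb{F}_q^*$. Identify $\mathbb{F}_q^{d+1}$ with the space of polynomials of degree at most $d$ in $\mathbb{F}_q[X]$. Let $W\le\mathbb{F}_q^{d+1}$ be a subspace of dimension $s$ with basis $P_1,\dots,P_s$, let $A(X)$ be the $s\times s$ matrix of polynomials with entries $A_{ij}(X)=P_j(X\omega^{i-1})$ ($1\le i,j\le s$), and let $L(X)=\det A(X)$. Then $L(X)$ has degree at most $ds-\binom{s}{2}$. -}

module Defs where

open import Level using (_⊔_)
open import Algebra.Bundles using (CommutativeRing)
open import Data.Nat as ℕ using (ℕ; zero; suc; _∸_)
open import Data.Nat.Primality using (Prime)
open import Data.Fin using (Fin; zero; suc; punchIn; toℕ)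
open import Data.Product using (Σ; ∃; ∃₂; _×_)
open import Relation.Nullary using (¬_)
open import Relation.Binary.PropositionalEquality using (_≡_)

IsPrimePower : ℕ → Set
IsPrimePower q = ∃₂ λ p k → Prime p × 1 ℕ.≤ k × q ≡ p ℕ.^ k

module _ {c ℓ} (R : CommutativeRing c ℓ) where
  open CommutativeRing R hiding (zero)

  IsField : Set (c ⊔ ℓ)
  IsField = (¬ 0# ≈ 1#) × (∀ x → ¬ x ≈ 0# → ∃ λ y → x * y ≈ 1#)

  HasCard : ℕ → Set (c ⊔ ℓ)
  HasCard q = Σ (Fin q → Carrier) λ e →
    (∀ i j → e i ≈ e j → i ≡ j) × (∀ x → ∃ λ i → e i ≈ x)

  pow : Carrier → ℕ → Carrier
  pow x zero = 1#
  pow x (suc n) = x * pow x n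

  IsGenerator : Carrier → Set (c ⊔ ℓ)
  IsGenerator ω = (¬ ω ≈ 0#) × (∀ x → ¬ x ≈ 0# → ∃ λ k → pow ω k ≈ x)

  sumFin : ∀ n → (Fin n → Carrier) → Carrier
  sumFin zero f = 0#
  sumFin (suc n) f = f zero + sumFin n (λ i → f (suc i))

  LinIndep : ∀ {s m} → (Fin s → Fin m → Carrier) → Set (c ⊔ ℓ)
  LinIndep {s} {m} P = ∀ (a : Fin s → Carrier) →
    (∀ k → sumFin s (λ j → a j * P j k) ≈ 0#) → ∀ j → a j ≈ 0#

  -- polynomials as coefficient sequences (coefficient of X^n at n)
  Poly : Set c
  Poly = ℕ → Carrier

  DegLe : Poly → ℕ → Set ℓ
  DegLe f D = ∀ n → D ℕ.< n → f n ≈ 0#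

  -- coefficient vector (a_0,…,a_d) ↦ polynomial a_0 + a_1 X + … + a_d X^d
  toPoly : ∀ {m} → (Fin m → Carrier) → Poly
  toPoly {zero} v n = 0#
  toPoly {suc m} v zero = v zero
  toPoly {suc m} v (suc n) = toPoly (λ i → v (suc i)) n

  subst-scale : Carrier → Poly → Poly
  subst-scale a f n = f n * pow a n

  0p 1p : Poly
  0p n = 0#
  1p zero = 1#
  1p (suc n) = 0#

  _+p_ : Poly → Poly → Poly
  (f +p g) n = f n + g n

  -p_ : Poly → Poly
  (-p f) n = - f n

  sumℕ : ℕ → (ℕ → Carrier) → Carrier
  sumℕ zero f = 0#
  sumℕ (suc n) f = f n + sumℕ n f

  _*p_ : Poly → Poly → Poly
  (f *p g) n = sumℕ (suc n) (λ k → f k * g (n ∸ k))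

  sumP : ∀ n → (Fin n → Poly) → Poly
  sumP zero f = 0p
  sumP (suc n) f = f zero +p sumP n (λ i → f (suc i))

  alt : ℕ → Poly → Poly
  alt zero f = f
  alt (suc k) f = -p (alt k f)

  det : ∀ n → (Fin n → Fin n → Poly) → Poly
  det zero M = 1p
  det (suc n) M = sumP (suc n) λ j →
    alt (toℕ j) (M zero j *p det n (λ i k → M (suc i) (punchIn j k)))

  -- A_{ij}(X) = P_j(X ω^{i-1}) (0-based indices: ω^i)
  shiftMatrix : ∀ {s d} → Carrier → (Fin s → Fin (suc d) → Carrier) → Fin s → Fin s → Poly
  shiftMatrix ω P i j = subst-scale (pow ω (toℕ i)) (toPoly (P j))

module Submission where

-- Writing P_j(X) = ∑_k P_j[k] X^k, the matrix A(X) factors as C(X) B with C_ik = (ω^i X)^k and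
-- B_kj = P_j[k].  Expanding det (C B) multilinearly in the rows gives a sum over maps
-- κ : {0..s-1} → {0..d} of ∏_i C_{i κ(i)} · det (B_{κ(i) j}); the determinant vanishes unless κ is
-- injective, and then the monomial ∏_i C_{i κ(i)} has degree ∑_i κ(i) ≤ d + (d-1) + … + (d-s+1)
-- = ds - C(s,2).  Nothing about F, ω or the P_j beyond commutativity of F is used.

open import Algebra.Bundles using (CommutativeRing)
open import Data.Fin using (Fin; zero; suc; toℕ; punchIn; punchOut)
open import Data.Fin.Properties
  using (_≟_; any?; toℕ<n; toℕ-injective; punchInᵢ≢i; punchIn-injective; punchOut-cong; punchOut-punchIn)
open import Data.Nat as Nat using (ℕ; zero; suc; _∸_; _≤_; _<_; z≤n)
import Data.Nat.Properties as ℕₚ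
open import Data.Nat.Combinatorics using (_C_; nC1≡n; nCk+nC[k+1]≡[n+1]C[k+1])
open import Data.Nat.Tactic.RingSolver using (solve-∀)
open import Data.Product using (∃; _,_; _×_)
open import Data.Empty using (⊥-elim)
open import Data.Sum using (_⊎_; inj₁; inj₂)
open import Data.Vec.Functional using (Vector; []; _∷_; tail)
open import Function using (_∘_)
open import Function.Definitions using (Injective)
open import Relation.Nullary using (Dec; yes; no)
open import Relation.Nullary.Decidable using (_×-dec_; ¬?)
open import Relation.Binary.PropositionalEquality as ≡ using (_≡_; _≢_)

import Algebra.Properties.CommutativeMonoid.Sum ℕₚ.+-0-commutativeMonoid as Σℕ

punchIn-punchOut-comm : ∀ {n} (j l : Fin (suc (suc n))) (j≢l : j ≢ l) (l≢j : l ≢ j) (k : Fin n) →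
  punchIn j (punchIn (punchOut j≢l) k) ≡ punchIn l (punchIn (punchOut l≢j) k)
punchIn-punchOut-comm zero    zero    j≢l _ _ with () ← j≢l ≡.refl
punchIn-punchOut-comm zero    (suc l) _   _ _ = ≡.refl
punchIn-punchOut-comm (suc j) zero    _   _ _ = ≡.refl
punchIn-punchOut-comm {suc n} (suc j) (suc l) _ _ zero = ≡.refl
punchIn-punchOut-comm {suc n} (suc j) (suc l) j≢l l≢j (suc k) =
  ≡.cong suc (punchIn-punchOut-comm j l (j≢l ∘ ≡.cong suc) (l≢j ∘ ≡.cong suc) k)

punchOut-punchIn′ : ∀ {n} (j : Fin (suc n)) (k : Fin n) (j≢jₖ : j ≢ punchIn j k) → punchOut j≢jₖ ≡ k
punchOut-punchIn′ j k _ = ≡.trans (punchOut-cong j ≡.refl) (punchOut-punchIn j)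

injective-or-collision : ∀ {n m} (f : Fin n → Fin m) →
  Injective _≡_ _≡_ f ⊎ ∃ λ i → ∃ λ j → i ≢ j × f i ≡ f j
injective-or-collision f with any? (λ i → any? (λ j → ¬? (i ≟ j) ×-dec (f i ≟ f j)))
... | yes collision = inj₂ collision
... | no no-collision = inj₁ injective
  where
  injective : Injective _≡_ _≡_ f
  injective {i} {j} fi≡fj with i ≟ j
  ... | yes i≡j = i≡j
  ... | no i≢j  = ⊥-elim (no-collision (i , j , i≢j , fi≡fj))

module _ where

  open Nat using (_+_; _*_)

  suc-+-suc-shift : ∀ {a b x y : ℕ} → a + x ≡ suc (b + y) → suc a + suc x ≡ suc (suc b + suc y)
  suc-+-suc-shift {a} {b} {x} {y} e = ≡.trans (≡.cong suc (ℕₚ.+-suc a x))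
    (≡.cong (λ z → suc (suc z)) (≡.trans e (≡.sym (ℕₚ.+-suc b y))))

  -- The (j , l) term of the Laplace expansion along the first two rows carries the sign
  -- (-1)^(j + position of l once column j is deleted); exchanging j and l flips it.
  punchOut-sign-flips : ∀ {n} (j l : Fin (suc (suc n))) (j≢l : j ≢ l) (l≢j : l ≢ j) →
    toℕ l + toℕ (punchOut l≢j) ≡ suc (toℕ j + toℕ (punchOut j≢l)) ⊎
    toℕ j + toℕ (punchOut j≢l) ≡ suc (toℕ l + toℕ (punchOut l≢j))
  punchOut-sign-flips zero    zero    j≢l _ with () ← j≢l ≡.refl
  punchOut-sign-flips zero    (suc l) _   _ = inj₁ (≡.cong suc (ℕₚ.+-identityʳ (toℕ l)))
  punchOut-sign-flips (suc j) zero    _   _ = inj₂ (≡.cong suc (ℕₚ.+-identityʳ (toℕ j)))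
  punchOut-sign-flips {zero}  (suc zero) (suc zero) j≢l _ with () ← j≢l ≡.refl
  punchOut-sign-flips {suc n} (suc j) (suc l) j≢l l≢j
    with punchOut-sign-flips j l (j≢l ∘ ≡.cong suc) (l≢j ∘ ≡.cong suc)
  ... | inj₁ e = inj₁ (suc-+-suc-shift e)
  ... | inj₂ e = inj₂ (suc-+-suc-shift e)

  -- s distinct values below m sum to at most (m - 1) + (m - 2) + … + (m - s) = m s - s - s(s-1)/2.
  sum-injective-bound : ∀ m s (κ : Fin s → ℕ) → (∀ i → κ i < m) → Injective _≡_ _≡_ κ →
    Σℕ.sum κ + s + s C 2 ≤ m * s
  sum-injective-bound zero    zero    κ κ<m κ-inj = z≤n
  sum-injective-bound zero    (suc s) κ κ<m κ-inj with () ← κ<m zero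
  sum-injective-bound (suc m) s       κ κ<m κ-inj with any? (λ i → κ i Nat.≟ m)
  ... | no m∉κ = ℕₚ.≤-trans (sum-injective-bound m s κ κ<m′ κ-inj) (ℕₚ.*-monoˡ-≤ s (ℕₚ.n≤1+n m))
    where κ<m′ : ∀ i → κ i < m
          κ<m′ i = ℕₚ.≤∧≢⇒< (ℕₚ.≤-pred (κ<m i)) (λ κi≡m → m∉κ (i , κi≡m))
  ... | yes (i₀ , κi₀≡m) = remove-top s κ κ<m κ-inj i₀ κi₀≡m
    where
    open ℕₚ.≤-Reasoning
    remove-top : ∀ s (κ : Fin s → ℕ) → (∀ i → κ i < suc m) → Injective _≡_ _≡_ κ →
      (i₀ : Fin s) → κ i₀ ≡ m → Σℕ.sum κ + s + s C 2 ≤ suc m * s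
    remove-top (suc s) κ κ<m κ-inj i₀ κi₀≡m = begin
      Σℕ.sum κ + suc s + suc s C 2
        ≡⟨ ≡.cong₂ (λ x y → x + suc s + y)
             (≡.trans (Σℕ.sum-remove {i = i₀} κ) (≡.cong (_+ Σℕ.sum κ′) κi₀≡m))
             (≡.trans (≡.sym (nCk+nC[k+1]≡[n+1]C[k+1] s 1)) (≡.cong (_+ s C 2) (nC1≡n s))) ⟩
      m + Σℕ.sum κ′ + suc s + (s + s C 2)
        ≡⟨ regroup m s (Σℕ.sum κ′) (s C 2) ⟩
      (Σℕ.sum κ′ + s + s C 2) + (m + s + 1)
        ≤⟨ ℕₚ.+-monoˡ-≤ (m + s + 1) (sum-injective-bound m s κ′ κ′<m κ′-inj) ⟩
      m * s + (m + s + 1)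
        ≡⟨ expand m s ⟨
      suc m * suc s ∎
      where
      κ′ : Fin s → ℕ
      κ′ = κ ∘ punchIn i₀
      κ′<m : ∀ i → κ′ i < m
      κ′<m i = ℕₚ.≤∧≢⇒< (ℕₚ.≤-pred (κ<m (punchIn i₀ i)))
        (λ κ′i≡m → punchInᵢ≢i i₀ i (κ-inj (≡.trans κ′i≡m (≡.sym κi₀≡m))))
      κ′-inj : Injective _≡_ _≡_ κ′
      κ′-inj = punchIn-injective i₀ _ _ ∘ κ-inj
      regroup : ∀ m s x y → m + x + suc s + (s + y) ≡ (x + s + y) + (m + s + 1)
      regroup = solve-∀
      expand : ∀ m s → suc m * suc s ≡ m * s + (m + s + 1)
      expand = solve-∀

  sum-injective-≤ : ∀ d s (κ : Fin s → ℕ) → (∀ i → κ i < suc d) → Injective _≡_ _≡_ κ →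
    Σℕ.sum κ ≤ d * s ∸ s C 2
  sum-injective-≤ d s κ κ<1+d κ-inj = ℕₚ.m+n≤o⇒m≤o∸n (Σℕ.sum κ) (ℕₚ.+-cancelˡ-≤ s _ _
    (ℕₚ.≤-trans (ℕₚ.≤-reflexive (regroup (Σℕ.sum κ) s (s C 2)))
                (sum-injective-bound (suc d) s κ κ<1+d κ-inj)))
    where regroup : ∀ x s y → s + (x + y) ≡ x + s + y
          regroup = solve-∀

module Determinant {c ℓ} (R : CommutativeRing c ℓ) where

  open CommutativeRing R hiding (zero)
  open import Algebra.Properties.Ring ring using (-‿involutive; -0#≈0#; -‿+-comm; -‿distribʳ-*)
  open import Algebra.Properties.Semiring.Sum semiring public using (sum; sum-cong-≋)
  open import Algebra.Properties.Monoid.Sum *-monoid public using () renaming (sum to product)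
  open import Algebra.Properties.Semiring.Sum semiring
    using (sum-replicate-zero; sum-remove; ∑-distrib-+; ∑-comm; *-distribˡ-sum; *-distribʳ-sum)
  open import Algebra.Properties.CommutativeSemigroup *-commutativeSemigroup using (interchange; x∙yz≈y∙xz)
  open import Relation.Binary.Reasoning.Setoid setoid

  Matrix : ℕ → Set c
  Matrix n = Fin n → Fin n → Carrier

  signed : ℕ → Carrier → Carrier
  signed zero    x = x
  signed (suc k) x = - signed k x

  minor : ∀ {n} → Matrix (suc n) → Fin (suc n) → Matrix n
  minor M j i k = M (suc i) (punchIn j k)

  det : ∀ n → Matrix n → Carrier
  det zero    M = 1#
  det (suc n) M = sum λ j → signed (toℕ j) (M zero j * det n (minor M j))

  sum-zero : ∀ {n} (f : Vector Carrier n) → (∀ i → f i ≈ 0#) → sum f ≈ 0#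
  sum-zero {n} _ f≈0 = trans (sum-cong-≋ f≈0) (sum-replicate-zero n)

  sum-neg : ∀ {n} (f : Vector Carrier n) → sum (λ i → - f i) ≈ - sum f
  sum-neg {zero}  f = sym -0#≈0#
  sum-neg {suc n} f = trans (+-congˡ (sum-neg (tail f))) (-‿+-comm _ _)

  -- The diagonal hypothesis is needed: antisymmetry only gives 2 f i i ≈ 0#.
  sum²-alternating : ∀ {n} (f : Fin n → Fin n → Carrier) →
    (∀ i → f i i ≈ 0#) → (∀ i j → f i j ≈ - f j i) → sum (λ i → sum (f i)) ≈ 0#
  sum²-alternating {zero}  f diag anti = refl
  sum²-alternating {suc n} f diag anti = begin
    (f zero zero + sum (f zero ∘ suc)) + sum (λ i → f (suc i) zero + sum (f (suc i) ∘ suc))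
      ≈⟨ +-cong (+-congʳ (diag zero)) (∑-distrib-+ (λ i → f (suc i) zero) _) ⟩
    (0# + sum (f zero ∘ suc)) + (sum (λ i → f (suc i) zero) + sum (λ i → sum (f (suc i) ∘ suc)))
      ≈⟨ +-cong (+-identityˡ _) (+-congˡ (sum²-alternating (λ i j → f (suc i) (suc j))
           (diag ∘ suc) (λ i j → anti (suc i) (suc j)))) ⟩
    sum (f zero ∘ suc) + (sum (λ i → f (suc i) zero) + 0#)
      ≈⟨ +-congˡ (+-identityʳ _) ⟩
    sum (f zero ∘ suc) + sum (λ i → f (suc i) zero)
      ≈⟨ ∑-distrib-+ (f zero ∘ suc) _ ⟨
    sum (λ i → f zero (suc i) + f (suc i) zero)
      ≈⟨ sum-zero _ (λ i → trans (+-congʳ (anti zero (suc i))) (-‿inverseˡ _)) ⟩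
    0# ∎

  signed-cong : ∀ k {x y} → x ≈ y → signed k x ≈ signed k y
  signed-cong zero    x≈y = x≈y
  signed-cong (suc k) x≈y = -‿cong (signed-cong k x≈y)

  signed-≡ : ∀ {k k′} x → k ≡ k′ → signed k x ≈ signed k′ x
  signed-≡ x ≡.refl = refl

  signed-*ˡ : ∀ k a x → signed k (a * x) ≈ a * signed k x
  signed-*ˡ zero    a x = refl
  signed-*ˡ (suc k) a x = trans (-‿cong (signed-*ˡ k a x)) (-‿distribʳ-* a _)

  signed-signed : ∀ k k′ x → signed k (signed k′ x) ≈ signed (k Nat.+ k′) x
  signed-signed zero    k′ x = refl
  signed-signed (suc k) k′ x = -‿cong (signed-signed k k′ x)

  signed-sum : ∀ k {n} (f : Vector Carrier n) → signed k (sum f) ≈ sum (λ i → signed k (f i))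
  signed-sum zero    f = refl
  signed-sum (suc k) f = trans (-‿cong (signed-sum k f)) (sym (sum-neg (λ i → signed k (f i))))

  signed-zero : ∀ k {x} → x ≈ 0# → signed k x ≈ 0#
  signed-zero zero    x≈0 = x≈0
  signed-zero (suc k) x≈0 = trans (-‿cong (signed-zero k x≈0)) -0#≈0#

  signed-flip : ∀ {k k′} x → k ≡ suc k′ ⊎ k′ ≡ suc k → signed k x ≈ - signed k′ x
  signed-flip x (inj₁ k≡1+k′) = signed-≡ x k≡1+k′
  signed-flip x (inj₂ k′≡1+k) = trans (sym (-‿involutive _)) (-‿cong (signed-≡ x (≡.sym k′≡1+k)))

  det-cong : ∀ n {M N : Matrix n} → (∀ i j → M i j ≈ N i j) → det n M ≈ det n N
  det-cong zero    M≈N = refl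
  det-cong (suc n) M≈N = sum-cong-≋ λ j → signed-cong (toℕ j)
    (*-cong (M≈N zero j) (det-cong n (λ i k → M≈N (suc i) (punchIn j k))))

  det-minors-zero : ∀ n (M : Matrix (suc n)) → (∀ j → det n (minor M j) ≈ 0#) → det (suc n) M ≈ 0#
  det-minors-zero n M minor≈0 = sum-zero _ λ j →
    signed-zero (toℕ j) (trans (*-congˡ (minor≈0 j)) (zeroʳ (M zero j)))

  module _ {n} (rest : Fin n → Vector Carrier (suc (suc n))) where

    cofactor₂ : (j l : Fin (suc (suc n))) → j ≢ l → Carrier
    cofactor₂ j l j≢l = signed (toℕ j Nat.+ toℕ (punchOut j≢l))
      (det n (λ i k → rest i (punchIn j (punchIn (punchOut j≢l) k))))

    cofactor₂-antisym : ∀ j l (j≢l : j ≢ l) (l≢j : l ≢ j) → cofactor₂ l j l≢j ≈ - cofactor₂ j l j≢l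
    cofactor₂-antisym j l j≢l l≢j =
      trans (signed-flip _ (punchOut-sign-flips j l j≢l l≢j))
            (-‿cong (signed-cong (toℕ j Nat.+ toℕ (punchOut j≢l)) (det-cong n λ i k →
              reflexive (≡.cong (rest i) (≡.sym (punchIn-punchOut-comm j l j≢l l≢j k))))))

    twoRowTerm′ : (u v : Vector Carrier (suc (suc n))) (j l : Fin (suc (suc n))) → Dec (j ≡ l) → Carrier
    twoRowTerm′ u v j l (yes _)   = 0#
    twoRowTerm′ u v j l (no j≢l) = u j * (v l * cofactor₂ j l j≢l)

    twoRowTerm : (u v : Vector Carrier (suc (suc n))) → Fin (suc (suc n)) → Fin (suc (suc n)) → Carrier
    twoRowTerm u v j l = twoRowTerm′ u v j l (j ≟ l)

    twoRowTerm-diag : ∀ u v j → twoRowTerm u v j j ≈ 0#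
    twoRowTerm-diag u v j with j ≟ j
    ... | yes _    = refl
    ... | no j≢j = ⊥-elim (j≢j ≡.refl)

    twoRowTerm-punchIn : ∀ u v j k → twoRowTerm u v j (punchIn j k) ≈
      u j * (v (punchIn j k) * signed (toℕ j Nat.+ toℕ k) (det n (λ i c → rest i (punchIn j (punchIn k c)))))
    twoRowTerm-punchIn u v j k with j ≟ punchIn j k
    ... | yes j≡jₖ = ⊥-elim (punchInᵢ≢i j k (≡.sym j≡jₖ))
    ... | no j≢jₖ rewrite punchOut-punchIn′ j k j≢jₖ = refl

    twoRowTerm-cong : ∀ {u u′ v v′} → (∀ k → u k ≈ u′ k) → (∀ k → v k ≈ v′ k) →
      ∀ j l → twoRowTerm u v j l ≈ twoRowTerm u′ v′ j l
    twoRowTerm-cong u≈u′ v≈v′ j l with j ≟ l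
    ... | yes _ = refl
    ... | no _  = *-cong (u≈u′ j) (*-congʳ (v≈v′ l))

    twoRowTerm-swap : ∀ u v j l → twoRowTerm v u l j ≈ - twoRowTerm u v j l
    twoRowTerm-swap u v j l with l ≟ j | j ≟ l
    ... | yes _   | yes _   = sym -0#≈0#
    ... | yes l≡j | no j≢l = ⊥-elim (j≢l (≡.sym l≡j))
    ... | no l≢j | yes j≡l = ⊥-elim (l≢j (≡.sym j≡l))
    ... | no l≢j | no j≢l = begin
      v l * (u j * cofactor₂ l j l≢j)     ≈⟨ x∙yz≈y∙xz _ _ _ ⟩
      u j * (v l * cofactor₂ l j l≢j)     ≈⟨ *-congˡ (*-congˡ (cofactor₂-antisym j l j≢l l≢j)) ⟩
      u j * (v l * - cofactor₂ j l j≢l)   ≈⟨ *-congˡ (-‿distribʳ-* _ _) ⟨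
      u j * - (v l * cofactor₂ j l j≢l)   ≈⟨ -‿distribʳ-* _ _ ⟨
      - (u j * (v l * cofactor₂ j l j≢l)) ∎

  det-laplace₂ : ∀ n (M : Matrix (suc (suc n))) →
    det (suc (suc n)) M ≈ sum (λ j → sum (twoRowTerm (tail (tail M)) (M zero) (M (suc zero)) j))
  det-laplace₂ n M = sum-cong-≋ λ j → begin
    signed (toℕ j) (M zero j * sum (inner j))
      ≈⟨ signed-*ˡ (toℕ j) (M zero j) (sum (inner j)) ⟩
    M zero j * signed (toℕ j) (sum (inner j))
      ≈⟨ *-congˡ (signed-sum (toℕ j) (inner j)) ⟩
    M zero j * sum (λ k → signed (toℕ j) (inner j k))
      ≈⟨ *-distribˡ-sum (M zero j) (λ k → signed (toℕ j) (inner j k)) ⟩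
    sum (λ k → M zero j * signed (toℕ j) (inner j k))
      ≈⟨ sum-cong-≋ (λ k → *-congˡ {M zero j} (trans (signed-signed (toℕ j) (toℕ k) (M₁ (punchIn j k) * D j k))
                                                     (signed-*ˡ (toℕ j Nat.+ toℕ k) (M₁ (punchIn j k)) (D j k)))) ⟩
    sum (λ k → M zero j * (M₁ (punchIn j k) * signed (toℕ j Nat.+ toℕ k) (D j k)))
      ≈⟨ sum-cong-≋ (λ k → twoRowTerm-punchIn rest (M zero) (M₁) j k) ⟨
    sum (λ k → G j (punchIn j k))
      ≈⟨ +-identityˡ _ ⟨
    0# + sum (λ k → G j (punchIn j k))
      ≈⟨ +-congʳ (twoRowTerm-diag rest (M zero) (M₁) j) ⟨
    G j j + sum (λ k → G j (punchIn j k))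
      ≈⟨ sum-remove (G j) ⟨
    sum (G j) ∎
    where
    M₁ = M (suc zero)
    rest = tail (tail M)
    G = twoRowTerm rest (M zero) (M₁)
    D : Fin (suc (suc n)) → Fin (suc n) → Carrier
    D j k = det n (λ i c → rest i (punchIn j (punchIn k c)))
    inner : Fin (suc (suc n)) → Fin (suc n) → Carrier
    inner j k = signed (toℕ k) (M₁ (punchIn j k) * D j k)

  det-swap₀₁ : ∀ n (M : Matrix (suc (suc n))) →
    det (suc (suc n)) (M (suc zero) ∷ M zero ∷ tail (tail M)) ≈ - det (suc (suc n)) M
  det-swap₀₁ n M = begin
    det (suc (suc n)) (M (suc zero) ∷ M zero ∷ rest)  ≈⟨ det-laplace₂ n (M (suc zero) ∷ M zero ∷ rest) ⟩
    sum (λ j → sum (λ l → G′ j l))                   ≈⟨ ∑-comm G′ ⟩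
    sum (λ l → sum (λ j → G′ j l))                   ≈⟨ sum-cong-≋ (λ l → sum-cong-≋ (swap l)) ⟩
    sum (λ l → sum (λ j → - G l j))                  ≈⟨ sum-cong-≋ (λ l → sum-neg (G l)) ⟩
    sum (λ l → - sum (G l))                          ≈⟨ sum-neg (λ l → sum (G l)) ⟩
    - sum (λ l → sum (G l))                          ≈⟨ -‿cong (det-laplace₂ n M) ⟨
    - det (suc (suc n)) M                            ∎
    where
    rest = tail (tail M)
    G  = twoRowTerm rest (M zero) (M (suc zero))
    G′ = twoRowTerm rest (M (suc zero)) (M zero)
    swap = twoRowTerm-swap rest (M zero) (M (suc zero))

  det-rows₀₁-equal : ∀ n (M : Matrix (suc (suc n))) → (∀ k → M zero k ≈ M (suc zero) k) →
    det (suc (suc n)) M ≈ 0#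
  det-rows₀₁-equal n M M₀≈M₁ = trans (det-laplace₂ n M) (sum²-alternating _
    (twoRowTerm-diag rest (M zero) (M (suc zero)))
    (λ j l → trans (twoRowTerm-cong rest M₀≈M₁ (sym ∘ M₀≈M₁) j l)
                   (twoRowTerm-swap rest (M zero) (M (suc zero)) l j)))
    where rest = tail (tail M)

  -- Rows 0 and b + 2 are brought to rows 0 and b + 1 of every minor by first exchanging rows 0 and 1.
  det-row₀-equal : ∀ n (M : Matrix (suc n)) (b : Fin n) → (∀ k → M zero k ≈ M (suc b) k) → det (suc n) M ≈ 0#
  det-row₀-equal (suc n)       M zero    M₀≈Mb = det-rows₀₁-equal n M M₀≈Mb
  det-row₀-equal (suc (suc n)) M (suc b) M₀≈Mb = begin
    det (suc (suc (suc n))) M      ≈⟨ -‿involutive _ ⟨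
    - - det (suc (suc (suc n))) M  ≈⟨ -‿cong (det-swap₀₁ (suc n) M) ⟨
    - det (suc (suc (suc n))) M′   ≈⟨ -‿cong (det-minors-zero (suc (suc n)) M′ λ j →
                                        det-row₀-equal (suc n) (minor M′ j) b (M₀≈Mb ∘ punchIn j)) ⟩
    - 0#                           ≈⟨ -0#≈0# ⟩
    0#                             ∎
    where M′ = M (suc zero) ∷ M zero ∷ tail (tail M)

  det-rows-equal : ∀ n (M : Matrix n) {a b} → a ≢ b → (∀ k → M a k ≈ M b k) → det n M ≈ 0#
  det-rows-equal (suc n) M {zero}  {zero}  a≢b _      = ⊥-elim (a≢b ≡.refl)
  det-rows-equal (suc n) M {zero}  {suc b} _   Ma≈Mb = det-row₀-equal n M b Ma≈Mb
  det-rows-equal (suc n) M {suc a} {zero}  _   Ma≈Mb = det-row₀-equal n M a (sym ∘ Ma≈Mb)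
  det-rows-equal (suc n) M {suc a} {suc b} a≢b Ma≈Mb = det-minors-zero n M λ j →
    det-rows-equal n (minor M j) (a≢b ∘ ≡.cong suc) (Ma≈Mb ∘ punchIn j)

  sumMaps : ∀ s {m} → ((Fin s → Fin m) → Carrier) → Carrier
  sumMaps zero    G = G []
  sumMaps (suc s) G = sum λ k → sumMaps s (λ κ → G (k ∷ κ))

  sumMaps-cong : ∀ s {m} {G H : (Fin s → Fin m) → Carrier} → (∀ κ → G κ ≈ H κ) → sumMaps s G ≈ sumMaps s H
  sumMaps-cong zero    G≈H = G≈H []
  sumMaps-cong (suc s) G≈H = sum-cong-≋ λ k → sumMaps-cong s (λ κ → G≈H (k ∷ κ))

  *-distribˡ-sumMaps : ∀ s {m} a (G : (Fin s → Fin m) → Carrier) → a * sumMaps s G ≈ sumMaps s (λ κ → a * G κ)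
  *-distribˡ-sumMaps zero    a G = refl
  *-distribˡ-sumMaps (suc s) a G = trans (*-distribˡ-sum a (λ k → sumMaps s (λ κ → G (k ∷ κ))))
    (sum-cong-≋ λ k → *-distribˡ-sumMaps s a (λ κ → G (k ∷ κ)))

  sumMaps-sum-comm : ∀ s {m n} (f : (Fin s → Fin m) → Fin n → Carrier) →
    sumMaps s (λ κ → sum (f κ)) ≈ sum (λ j → sumMaps s (λ κ → f κ j))
  sumMaps-sum-comm zero    f = refl
  sumMaps-sum-comm (suc s) f = trans (sum-cong-≋ λ k → sumMaps-sum-comm s (λ κ → f (k ∷ κ)))
    (∑-comm (λ k j → sumMaps s (λ κ → f (k ∷ κ) j)))

  signed-sumMaps : ∀ k s {m} (G : (Fin s → Fin m) → Carrier) →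
    signed k (sumMaps s G) ≈ sumMaps s (λ κ → signed k (G κ))
  signed-sumMaps k zero    G = refl
  signed-sumMaps k (suc s) G = trans (signed-sum k (λ l → sumMaps s (λ κ → G (l ∷ κ))))
    (sum-cong-≋ λ l → signed-sumMaps k s (λ κ → G (l ∷ κ)))

  -- The Cauchy–Binet expansion before the non-injective κ are discarded.
  det-expand : ∀ s {m} (C : Fin s → Fin m → Carrier) (B : Fin m → Fin s → Carrier) →
    det s (λ i j → sum (λ k → C i k * B k j)) ≈
    sumMaps s (λ κ → product (λ i → C i (κ i)) * det s (B ∘ κ))
  det-expand zero    C B = sym (*-identityˡ 1#)
  det-expand (suc s) {m} C B = begin
    sum (λ j → signed (toℕ j) (sum (λ k → C zero k * B k j) * det s (minor CB j)))
      ≈⟨ sum-cong-≋ (λ j → signed-cong (toℕ j) (*-congˡ {sum (λ k → C zero k * B k j)}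
           (det-expand s (C ∘ suc) (λ k l → B k (punchIn j l))))) ⟩
    sum (λ j → signed (toℕ j) (sum (λ k → C zero k * B k j) * sumMaps s (rest j)))
      ≈⟨ sum-cong-≋ (λ j → signed-cong (toℕ j) (distribute j)) ⟩
    sum (λ j → signed (toℕ j) (sum (λ k → sumMaps s (λ κ → U k κ * V j k κ))))
      ≈⟨ sum-cong-≋ (λ j → push-sign j) ⟩
    sum (λ j → sum (λ k → sumMaps s (λ κ → U k κ * signed (toℕ j) (V j k κ))))
      ≈⟨ ∑-comm (λ j k → sumMaps s (λ κ → U k κ * signed (toℕ j) (V j k κ))) ⟩
    sum (λ k → sum (λ j → sumMaps s (λ κ → U k κ * signed (toℕ j) (V j k κ))))
      ≈⟨ sum-cong-≋ (λ k → sumMaps-sum-comm s (λ κ j → U k κ * signed (toℕ j) (V j k κ))) ⟨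
    sum (λ k → sumMaps s (λ κ → sum (λ j → U k κ * signed (toℕ j) (V j k κ))))
      ≈⟨ sum-cong-≋ (λ k → sumMaps-cong s λ κ →
           *-distribˡ-sum (U k κ) (λ j → signed (toℕ j) (V j k κ))) ⟨
    sum (λ k → sumMaps s (λ κ → U k κ * sum (λ j → signed (toℕ j) (V j k κ)))) ∎
    where
    CB : Matrix (suc s)
    CB i j = sum (λ k → C i k * B k j)
    rest : Fin (suc s) → (Fin s → Fin m) → Carrier
    rest j κ = product (λ i → C (suc i) (κ i)) * det s (λ i l → B (κ i) (punchIn j l))
    U : Fin m → (Fin s → Fin m) → Carrier
    U k κ = C zero k * product (λ i → C (suc i) (κ i))
    V : Fin (suc s) → Fin m → (Fin s → Fin m) → Carrier
    V j k κ = B k j * det s (λ i l → B (κ i) (punchIn j l))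
    distribute : ∀ j → sum (λ k → C zero k * B k j) * sumMaps s (rest j) ≈
      sum (λ k → sumMaps s (λ κ → U k κ * V j k κ))
    distribute j = trans (*-distribʳ-sum (sumMaps s (rest j)) (λ k → C zero k * B k j)) (sum-cong-≋ λ k →
      trans (*-distribˡ-sumMaps s (C zero k * B k j) (rest j)) (sumMaps-cong s (λ κ → interchange _ _ _ _)))
    push-sign : ∀ j → signed (toℕ j) (sum (λ k → sumMaps s (λ κ → U k κ * V j k κ))) ≈
      sum (λ k → sumMaps s (λ κ → U k κ * signed (toℕ j) (V j k κ)))
    push-sign j = trans (signed-sum (toℕ j) (λ k → sumMaps s (λ κ → U k κ * V j k κ))) (sum-cong-≋ λ k →
      trans (signed-sumMaps (toℕ j) s (λ κ → U k κ * V j k κ))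
            (sumMaps-cong s (λ κ → signed-*ˡ (toℕ j) (U k κ) (V j k κ))))

  module _ {p} (Q : Carrier → Set p) (Q-0# : Q 0#) (Q-+ : ∀ {x y} → Q x → Q y → Q (x + y)) where

    sum-closed : ∀ {n} (f : Vector Carrier n) → (∀ i → Q (f i)) → Q (sum f)
    sum-closed {zero}  f Qf = Q-0#
    sum-closed {suc n} f Qf = Q-+ (Qf zero) (sum-closed (tail f) (Qf ∘ suc))

    sumMaps-closed : ∀ s {m} (G : (Fin s → Fin m) → Carrier) → (∀ κ → Q (G κ)) → Q (sumMaps s G)
    sumMaps-closed zero    G QG = QG []
    sumMaps-closed (suc s) G QG = sum-closed _ λ k → sumMaps-closed s (λ κ → G (k ∷ κ)) (λ κ → QG (k ∷ κ))

    det-closed : Q 1# → (∀ {x y} → Q x → Q y → Q (x * y)) → (∀ {x} → Q x → Q (- x)) →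
      ∀ n (M : Matrix n) → (∀ i j → Q (M i j)) → Q (det n M)
    det-closed Q-1# Q-* Q-neg zero    M QM = Q-1#
    det-closed Q-1# Q-* Q-neg (suc n) M QM = sum-closed _ λ j →
      signed-closed (toℕ j) (Q-* (QM zero j) (det-closed Q-1# Q-* Q-neg n (minor M j) (λ i k → QM (suc i) (punchIn j k))))
      where
      signed-closed : ∀ k {x} → Q x → Q (signed k x)
      signed-closed zero    Qx = Qx
      signed-closed (suc k) Qx = Q-neg (signed-closed k Qx)

open import Defs

module Polynomial {c ℓ} (F : CommutativeRing c ℓ) where

  open CommutativeRing F hiding (zero)
  open import Algebra.Properties.Ring ring using (-0#≈0#)
  open import Algebra.Properties.Semiring.Sum semiring using (sum; sum-replicate-zero)
  open import Algebra.Properties.CommutativeSemigroup +-commutativeSemigroup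
    using () renaming (interchange to +-interchange; x∙yz≈y∙xz to +-exchange)
  open import Relation.Binary.Reasoning.Setoid setoid

  infix  4 _≈ₚ_
  infixl 6 _+ₚ_
  infixl 7 _*ₚ_

  _≈ₚ_ : Poly F → Poly F → Set ℓ
  f ≈ₚ g = ∀ n → f n ≈ g n

  _+ₚ_ _*ₚ_ : Poly F → Poly F → Poly F
  _+ₚ_ = _+p_ F
  _*ₚ_ = _*p_ F

  scale : Carrier → Poly F → Poly F
  scale a f n = a * f n

  sumℕ-cong< : ∀ n {f g : ℕ → Carrier} → (∀ k → k < n → f k ≈ g k) → sumℕ F n f ≈ sumℕ F n g
  sumℕ-cong< zero    f≈g = refl
  sumℕ-cong< (suc n) f≈g = +-cong (f≈g n (ℕₚ.n<1+n n)) (sumℕ-cong< n (λ k k<n → f≈g k (ℕₚ.m<n⇒m<1+n k<n)))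

  sumℕ-cong : ∀ n {f g : ℕ → Carrier} → (∀ k → f k ≈ g k) → sumℕ F n f ≈ sumℕ F n g
  sumℕ-cong n f≈g = sumℕ-cong< n (λ k _ → f≈g k)

  sumℕ-zero : ∀ n {f : ℕ → Carrier} → (∀ k → k < n → f k ≈ 0#) → sumℕ F n f ≈ 0#
  sumℕ-zero zero    f≈0 = refl
  sumℕ-zero (suc n) f≈0 =
    trans (+-cong (f≈0 n (ℕₚ.n<1+n n)) (sumℕ-zero n (λ k k<n → f≈0 k (ℕₚ.m<n⇒m<1+n k<n)))) (+-identityˡ 0#)

  sumℕ-unfoldˡ : ∀ n (f : ℕ → Carrier) → sumℕ F (suc n) f ≈ f 0 + sumℕ F n (f ∘ suc)
  sumℕ-unfoldˡ zero    f = refl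
  sumℕ-unfoldˡ (suc n) f = trans (+-congˡ (sumℕ-unfoldˡ n f)) (+-exchange _ _ _)

  sumℕ-+ : ∀ n (f g : ℕ → Carrier) → sumℕ F n (λ k → f k + g k) ≈ sumℕ F n f + sumℕ F n g
  sumℕ-+ zero    f g = sym (+-identityˡ 0#)
  sumℕ-+ (suc n) f g = trans (+-congˡ (sumℕ-+ n f g)) (+-interchange _ _ _ _)

  *-distribˡ-sumℕ : ∀ n a (f : ℕ → Carrier) → a * sumℕ F n f ≈ sumℕ F n (λ k → a * f k)
  *-distribˡ-sumℕ zero    a f = zeroʳ a
  *-distribˡ-sumℕ (suc n) a f = trans (distribˡ a _ _) (+-congˡ (*-distribˡ-sumℕ n a f))

  *ₚ-zeroth : ∀ f g → (f *ₚ g) 0 ≈ f 0 * g 0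
  *ₚ-zeroth f g = +-identityʳ _

  *ₚ-unfoldˡ : ∀ f g n → (f *ₚ g) (suc n) ≈ f 0 * g (suc n) + ((f ∘ suc) *ₚ g) n
  *ₚ-unfoldˡ f g n = sumℕ-unfoldˡ (suc n) (λ k → f k * g (suc n ∸ k))

  -- The subtraction suc n ∸ k is not truncated for the indices k < suc n that occur.
  *ₚ-unfoldʳ : ∀ f g n → (f *ₚ g) (suc n) ≈ f (suc n) * g 0 + (f *ₚ (g ∘ suc)) n
  *ₚ-unfoldʳ f g n = +-cong (*-congˡ (reflexive (≡.cong g (ℕₚ.n∸n≡0 n))))
    (sumℕ-cong< (suc n) (λ k k<n → *-congˡ (reflexive (≡.cong g (ℕₚ.+-∸-assoc 1 (ℕₚ.≤-pred k<n))))))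

  *ₚ-cong : ∀ {f f′ g g′} → f ≈ₚ f′ → g ≈ₚ g′ → f *ₚ g ≈ₚ f′ *ₚ g′
  *ₚ-cong f≈f′ g≈g′ n = sumℕ-cong (suc n) (λ k → *-cong (f≈f′ k) (g≈g′ (n ∸ k)))

  *ₚ-zeroˡ : ∀ f → 0p F *ₚ f ≈ₚ 0p F
  *ₚ-zeroˡ f n = sumℕ-zero (suc n) (λ k _ → zeroˡ _)

  *ₚ-comm : ∀ f g → f *ₚ g ≈ₚ g *ₚ f
  *ₚ-comm f g zero    = trans (*ₚ-zeroth f g) (trans (*-comm _ _) (sym (*ₚ-zeroth g f)))
  *ₚ-comm f g (suc n) = trans (*ₚ-unfoldˡ f g n)
    (trans (+-cong (*-comm _ _) (*ₚ-comm (f ∘ suc) g n)) (sym (*ₚ-unfoldʳ g f n)))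

  *ₚ-distribʳ : ∀ h f g → (f +ₚ g) *ₚ h ≈ₚ f *ₚ h +ₚ g *ₚ h
  *ₚ-distribʳ h f g n = trans (sumℕ-cong (suc n) (λ k → distribʳ _ _ _)) (sumℕ-+ (suc n) _ _)

  *ₚ-distribˡ : ∀ h f g → h *ₚ (f +ₚ g) ≈ₚ h *ₚ f +ₚ h *ₚ g
  *ₚ-distribˡ h f g n = trans (sumℕ-cong (suc n) (λ k → distribˡ _ _ _)) (sumℕ-+ (suc n) _ _)

  scale-*ₚ : ∀ a g h → scale a g *ₚ h ≈ₚ scale a (g *ₚ h)
  scale-*ₚ a g h n = trans (sumℕ-cong (suc n) (λ k → *-assoc _ _ _)) (sym (*-distribˡ-sumℕ (suc n) a _))

  *ₚ-assoc : ∀ f g h → (f *ₚ g) *ₚ h ≈ₚ f *ₚ (g *ₚ h)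
  *ₚ-assoc f g h zero = begin
    ((f *ₚ g) *ₚ h) 0   ≈⟨ *ₚ-zeroth (f *ₚ g) h ⟩
    (f *ₚ g) 0 * h 0    ≈⟨ *-congʳ (*ₚ-zeroth f g) ⟩
    (f 0 * g 0) * h 0   ≈⟨ *-assoc _ _ _ ⟩
    f 0 * (g 0 * h 0)   ≈⟨ *-congˡ (*ₚ-zeroth g h) ⟨
    f 0 * (g *ₚ h) 0    ≈⟨ *ₚ-zeroth f (g *ₚ h) ⟨
    (f *ₚ (g *ₚ h)) 0   ∎
  *ₚ-assoc f g h (suc n) = begin
    ((f *ₚ g) *ₚ h) (suc n)
      ≈⟨ *ₚ-unfoldˡ (f *ₚ g) h n ⟩
    (f *ₚ g) 0 * h (suc n) + (((f *ₚ g) ∘ suc) *ₚ h) n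
      ≈⟨ +-cong (*-congʳ (*ₚ-zeroth f g)) (*ₚ-cong {g = h} (*ₚ-unfoldˡ f g) (λ _ → refl) n) ⟩
    (f 0 * g 0) * h (suc n) + ((scale (f 0) (g ∘ suc) +ₚ (f ∘ suc) *ₚ g) *ₚ h) n
      ≈⟨ +-congˡ (*ₚ-distribʳ h _ _ n) ⟩
    (f 0 * g 0) * h (suc n) + ((scale (f 0) (g ∘ suc) *ₚ h) n + (((f ∘ suc) *ₚ g) *ₚ h) n)
      ≈⟨ +-congˡ (+-cong (scale-*ₚ _ _ h n) (*ₚ-assoc (f ∘ suc) g h n)) ⟩
    (f 0 * g 0) * h (suc n) + (f 0 * ((g ∘ suc) *ₚ h) n + ((f ∘ suc) *ₚ (g *ₚ h)) n)
      ≈⟨ +-assoc _ _ _ ⟨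
    ((f 0 * g 0) * h (suc n) + f 0 * ((g ∘ suc) *ₚ h) n) + ((f ∘ suc) *ₚ (g *ₚ h)) n
      ≈⟨ +-congʳ (trans (+-congʳ (*-assoc _ _ _)) (sym (distribˡ _ _ _))) ⟩
    f 0 * (g 0 * h (suc n) + ((g ∘ suc) *ₚ h) n) + ((f ∘ suc) *ₚ (g *ₚ h)) n
      ≈⟨ +-congʳ (*-congˡ (*ₚ-unfoldˡ g h n)) ⟨
    f 0 * (g *ₚ h) (suc n) + ((f ∘ suc) *ₚ (g *ₚ h)) n
      ≈⟨ *ₚ-unfoldˡ f (g *ₚ h) n ⟨
    (f *ₚ (g *ₚ h)) (suc n) ∎

  *ₚ-identityˡ : ∀ f → 1p F *ₚ f ≈ₚ f
  *ₚ-identityˡ f zero    = trans (*ₚ-zeroth (1p F) f) (*-identityˡ _)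
  *ₚ-identityˡ f (suc n) =
    trans (*ₚ-unfoldˡ (1p F) f n) (trans (+-cong (*-identityˡ _) (*ₚ-zeroˡ f n)) (+-identityʳ _))

  commutativeRing : CommutativeRing c ℓ
  commutativeRing = record
    { Carrier = Poly F
    ; _≈_ = _≈ₚ_
    ; _+_ = _+ₚ_
    ; _*_ = _*ₚ_
    ; -_ = -p_ F
    ; 0# = 0p F
    ; 1# = 1p F
    ; isCommutativeRing = record
      { isRing = record
        { +-isAbelianGroup = record
          { isGroup = record
            { isMonoid = record
              { isSemigroup = record
                { isMagma = record
                  { isEquivalence = record
                    { refl  = λ n → refl
                    ; sym   = λ f≈g n → sym (f≈g n)
                    ; trans = λ f≈g g≈h n → trans (f≈g n) (g≈h n) }
                  ; ∙-cong = λ f≈f′ g≈g′ n → +-cong (f≈f′ n) (g≈g′ n) }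
                ; assoc = λ f g h n → +-assoc _ _ _ }
              ; identity = (λ f n → +-identityˡ _) , (λ f n → +-identityʳ _) }
            ; inverse = (λ f n → -‿inverseˡ _) , (λ f n → -‿inverseʳ _)
            ; ⁻¹-cong = λ f≈g n → -‿cong (f≈g n) }
          ; comm = λ f g n → +-comm _ _ }
        ; *-cong = *ₚ-cong
        ; *-assoc = *ₚ-assoc
        ; *-identity = *ₚ-identityˡ , (λ f n → trans (*ₚ-comm f (1p F) n) (*ₚ-identityˡ f n))
        ; distrib = *ₚ-distribˡ , *ₚ-distribʳ }
      ; *-comm = *ₚ-comm }
    }

  module Detₚ = Determinant commutativeRing

  sumP-≈ₚ : ∀ n (f : Fin n → Poly F) → sumP F n f ≈ₚ Detₚ.sum f
  sumP-≈ₚ zero    f k = refl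
  sumP-≈ₚ (suc n) f k = +-congˡ (sumP-≈ₚ n (f ∘ suc) k)

  alt-≈ₚ : ∀ m f → alt F m f ≈ₚ Detₚ.signed m f
  alt-≈ₚ zero    f k = refl
  alt-≈ₚ (suc m) f k = -‿cong (alt-≈ₚ m f k)

  det-≈ₚ : ∀ n (M : Fin n → Fin n → Poly F) → det F n M ≈ₚ Detₚ.det n M
  det-≈ₚ zero    M k = refl
  det-≈ₚ (suc n) M k = trans (sumP-≈ₚ (suc n) (λ j → alt F (toℕ j) (M zero j *ₚ det F n (Detₚ.minor M j))) k)
    (Detₚ.sum-cong-≋ (λ j k → trans (alt-≈ₚ (toℕ j) _ k)
      (Detₚ.signed-cong (toℕ j) (*ₚ-cong {M zero j} (λ _ → refl) (det-≈ₚ n (Detₚ.minor M j))) k)) k)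

  sumₚ-at : ∀ {m} (f : Fin m → Poly F) n → Detₚ.sum f n ≈ sum (λ k → f k n)
  sumₚ-at {zero}  f n = refl
  sumₚ-at {suc m} f n = +-congˡ (sumₚ-at (f ∘ suc) n)

  monomial : Carrier → ℕ → Poly F
  monomial a zero    zero    = a
  monomial a zero    (suc n) = 0#
  monomial a (suc k) zero    = 0#
  monomial a (suc k) (suc n) = monomial a k n

  constant : Carrier → Poly F
  constant a = monomial a 0

  monomial-cong : ∀ k {a b} → a ≈ b → monomial a k ≈ₚ monomial b k
  monomial-cong zero    a≈b zero    = a≈b
  monomial-cong zero    a≈b (suc n) = refl
  monomial-cong (suc k) a≈b zero    = refl
  monomial-cong (suc k) a≈b (suc n) = monomial-cong k a≈b n

  monomial-diag : ∀ a k → monomial a k k ≈ a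
  monomial-diag a zero    = refl
  monomial-diag a (suc k) = monomial-diag a k

  monomial-off : ∀ a k n → k ≢ n → monomial a k n ≈ 0#
  monomial-off a zero    zero    k≢n = ⊥-elim (k≢n ≡.refl)
  monomial-off a zero    (suc n) k≢n = refl
  monomial-off a (suc k) zero    k≢n = refl
  monomial-off a (suc k) (suc n) k≢n = monomial-off a k n (k≢n ∘ ≡.cong suc)

  scale-monomial : ∀ a b k → scale a (monomial b k) ≈ₚ monomial (a * b) k
  scale-monomial a b zero    zero    = refl
  scale-monomial a b zero    (suc n) = zeroʳ a
  scale-monomial a b (suc k) zero    = zeroʳ a
  scale-monomial a b (suc k) (suc n) = scale-monomial a b k n

  constant-*ₚ : ∀ a f → constant a *ₚ f ≈ₚ scale a f
  constant-*ₚ a f zero    = *ₚ-zeroth (constant a) f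
  constant-*ₚ a f (suc n) = trans (*ₚ-unfoldˡ (constant a) f n) (trans (+-congˡ (*ₚ-zeroˡ f n)) (+-identityʳ _))

  monomial-*ₚ-constant : ∀ a k b → monomial a k *ₚ constant b ≈ₚ monomial (a * b) k
  monomial-*ₚ-constant a k b n = trans (*ₚ-comm (monomial a k) (constant b) n)
    (trans (constant-*ₚ b (monomial a k) n) (trans (scale-monomial b a k n) (monomial-cong k (*-comm b a) n)))

  monomial-substScale : ∀ b a k n → monomial (pow F b k * a) k n ≈ monomial a k n * pow F b n
  monomial-substScale b a k n with k Nat.≟ n
  ... | yes ≡.refl = trans (monomial-diag _ k) (trans (*-comm _ _) (*-congʳ (sym (monomial-diag a k))))
  ... | no k≢n    = trans (monomial-off _ k n k≢n) (sym (trans (*-congʳ (monomial-off a k n k≢n)) (zeroˡ _)))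

  toPoly-monomials : ∀ m (v : Fin m → Carrier) n → toPoly F v n ≈ sum (λ k → monomial (v k) (toℕ k) n)
  toPoly-monomials zero    v n       = refl
  toPoly-monomials (suc m) v zero    = sym (trans (+-congˡ (sum-replicate-zero m)) (+-identityʳ _))
  toPoly-monomials (suc m) v (suc n) = trans (toPoly-monomials m (v ∘ suc) n) (sym (+-identityˡ _))

  degLe-cong : ∀ {f g D} → f ≈ₚ g → DegLe F f D → DegLe F g D
  degLe-cong f≈g deg-f n D<n = trans (sym (f≈g n)) (deg-f n D<n)

  degLe-weaken : ∀ {f D D′} → D ≤ D′ → DegLe F f D → DegLe F f D′
  degLe-weaken D≤D′ deg-f n D′<n = deg-f n (ℕₚ.≤-<-trans D≤D′ D′<n)

  degLe-0ₚ : ∀ D → DegLe F (0p F) D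
  degLe-0ₚ D n _ = refl

  degLe-1ₚ : DegLe F (1p F) 0
  degLe-1ₚ (suc n) _ = refl

  degLe-+ₚ : ∀ {f g D} → DegLe F f D → DegLe F g D → DegLe F (f +ₚ g) D
  degLe-+ₚ deg-f deg-g n D<n = trans (+-cong (deg-f n D<n) (deg-g n D<n)) (+-identityˡ 0#)

  degLe-negₚ : ∀ {f D} → DegLe F f D → DegLe F (-p_ F f) D
  degLe-negₚ deg-f n D<n = trans (-‿cong (deg-f n D<n)) -0#≈0#

  -- In each term f k * g (n ∸ k) of the coefficient, either k > a or n ∸ k > b.
  degLe-*ₚ : ∀ {f g a b} → DegLe F f a → DegLe F g b → DegLe F (f *ₚ g) (a Nat.+ b)
  degLe-*ₚ {f} {g} {a} {b} deg-f deg-g n a+b<n = sumℕ-zero (suc n) term-zero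
    where
    term-zero : ∀ k → k < suc n → f k * g (n ∸ k) ≈ 0#
    term-zero k _ with a Nat.<? k
    ... | yes a<k = trans (*-congʳ (deg-f k a<k)) (zeroˡ _)
    ... | no a≮k = trans (*-congˡ (deg-g (n ∸ k) b<n∸k)) (zeroʳ _)
      where
      b+k<n : b Nat.+ k < n
      b+k<n = ℕₚ.≤-<-trans (ℕₚ.≤-trans (ℕₚ.+-monoʳ-≤ b (ℕₚ.≮⇒≥ a≮k)) (ℕₚ.≤-reflexive (ℕₚ.+-comm b a)))
                           a+b<n
      b<n∸k : b < n ∸ k
      b<n∸k = ≡.subst (_< n ∸ k) (ℕₚ.m+n∸n≡m b k) (ℕₚ.∸-monoˡ-< b+k<n (ℕₚ.m≤n+m k b))

  degLe-monomial : ∀ a k → DegLe F (monomial a k) k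
  degLe-monomial a zero    (suc n) _         = refl
  degLe-monomial a (suc k) (suc n) (Nat.s≤s k<n) = degLe-monomial a k n k<n

  degLe-product : ∀ {s} (f : Fin s → Poly F) (D : Fin s → ℕ) → (∀ i → DegLe F (f i) (D i)) →
    DegLe F (Detₚ.product f) (Σℕ.sum D)
  degLe-product {zero}  f D deg-f = degLe-1ₚ
  degLe-product {suc s} f D deg-f = degLe-*ₚ (deg-f zero) (degLe-product (f ∘ suc) (D ∘ suc) (deg-f ∘ suc))

  degLe-det : ∀ n (M : Fin n → Fin n → Poly F) → (∀ i j → DegLe F (M i j) 0) → DegLe F (Detₚ.det n M) 0
  degLe-det = Detₚ.det-closed (λ f → DegLe F f 0) (degLe-0ₚ 0) degLe-+ₚ degLe-1ₚ degLe-*ₚ degLe-negₚ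

module ShiftMatrix {c ℓ} (F : CommutativeRing c ℓ) (d s : ℕ) (ω : CommutativeRing.Carrier F)
  (P : Fin s → Fin (suc d) → CommutativeRing.Carrier F) where

  open CommutativeRing F hiding (zero)
  open Polynomial F
  open import Algebra.Properties.Semiring.Sum semiring using (sum; sum-cong-≋; *-distribʳ-sum)
  open import Relation.Binary.Reasoning.Setoid setoid

  -- Row i of the shift matrix is (P_j(ω^i X))_j = ∑_k (ω^i X)^k P_j[k].
  powers : Fin s → Fin (suc d) → Poly F
  powers i k = monomial (pow F (pow F ω (toℕ i)) (toℕ k)) (toℕ k)

  coefficients : Fin (suc d) → Fin s → Poly F
  coefficients k j = constant (P j k)

  shiftMatrix-factorises : ∀ i j → shiftMatrix F ω P i j ≈ₚ Detₚ.sum (λ k → powers i k *ₚ coefficients k j)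
  shiftMatrix-factorises i j n = begin
    toPoly F (P j) n * pow F b n
      ≈⟨ *-congʳ (toPoly-monomials (suc d) (P j) n) ⟩
    sum (λ k → monomial (P j k) (toℕ k) n) * pow F b n
      ≈⟨ *-distribʳ-sum (pow F b n) (λ k → monomial (P j k) (toℕ k) n) ⟩
    sum (λ k → monomial (P j k) (toℕ k) n * pow F b n)
      ≈⟨ sum-cong-≋ (λ k → monomial-substScale b (P j k) (toℕ k) n) ⟨
    sum (λ k → monomial (pow F b (toℕ k) * P j k) (toℕ k) n)
      ≈⟨ sum-cong-≋ (λ k → monomial-*ₚ-constant (pow F b (toℕ k)) (toℕ k) (P j k) n) ⟨
    sum (λ k → (powers i k *ₚ coefficients k j) n)
      ≈⟨ sumₚ-at (λ k → powers i k *ₚ coefficients k j) n ⟨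
    Detₚ.sum (λ k → powers i k *ₚ coefficients k j) n ∎
    where b = pow F ω (toℕ i)

  bound : ℕ
  bound = d Nat.* s ∸ s C 2

  term : (Fin s → Fin (suc d)) → Poly F
  term κ = Detₚ.product (λ i → powers i (κ i)) *ₚ Detₚ.det s (coefficients ∘ κ)

  term-degLe : ∀ κ → DegLe F (term κ) bound
  term-degLe κ with injective-or-collision κ
  ... | inj₁ κ-inj = degLe-weaken Σκ+0≤bound
    (degLe-*ₚ (degLe-product _ (toℕ ∘ κ) (λ i → degLe-monomial _ (toℕ (κ i))))
              (degLe-det s (coefficients ∘ κ) (λ i j → degLe-monomial (P j (κ i)) 0)))
    where
    Σκ+0≤bound : Σℕ.sum (toℕ ∘ κ) Nat.+ 0 ≤ bound
    Σκ+0≤bound = ℕₚ.≤-trans (ℕₚ.≤-reflexive (ℕₚ.+-identityʳ _))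
      (sum-injective-≤ d s (toℕ ∘ κ) (toℕ<n ∘ κ) (κ-inj ∘ toℕ-injective))
  ... | inj₂ (i , i′ , i≢i′ , κi≡κi′) = degLe-cong (λ n → sym (term≈0 n)) (degLe-0ₚ bound)
    where
    term≈0 : term κ ≈ₚ 0p F
    term≈0 n = trans (*ₚ-cong {Detₚ.product (λ i → powers i (κ i))} (λ _ → refl)
        (Detₚ.det-rows-equal s (coefficients ∘ κ) i≢i′
          (λ j → monomial-cong 0 (reflexive (≡.cong (P j) κi≡κi′)))) n)
      (CommutativeRing.zeroʳ commutativeRing _ n)

  det-shiftMatrix-degLe : DegLe F (det F s (shiftMatrix F ω P)) bound
  det-shiftMatrix-degLe = degLe-cong (λ n → sym (expansion n))
    (Detₚ.sumMaps-closed (λ f → DegLe F f bound) (degLe-0ₚ bound) degLe-+ₚ s term term-degLe)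
    where
    expansion : det F s (shiftMatrix F ω P) ≈ₚ Detₚ.sumMaps s term
    expansion n = trans (det-≈ₚ s _ n) (trans (Detₚ.det-cong s shiftMatrix-factorises n)
      (Detₚ.det-expand s powers coefficients n))

open Nat using (_*_)

mainTheorem11 : ∀ {c ℓ} (F : CommutativeRing c ℓ) → IsField F →
    (q : ℕ) → IsPrimePower q → HasCard F q →
    (d s t : ℕ) → 1 ≤ d → 1 ≤ s → 1 ≤ t → s ≤ t → t ≤ suc d → suc d < q →
    (ω : CommutativeRing.Carrier F) → IsGenerator F ω →
    (P : Fin s → Fin (suc d) → CommutativeRing.Carrier F) → LinIndep F P →
    DegLe F (det F s (shiftMatrix F ω P)) (d * s ∸ s C 2)
mainTheorem11 F _ _ _ _ d s _ _ _ _ _ _ _ ω _ P _ = ShiftMatrix.det-shiftMatrix-degLe F d s ω P
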